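{- Let $n\ge 1$, $A\subseteq\{1,\dots,n\}$ nonempty, and let $\mathbf p,\mathbf q$ be positions of $SN(n,A)$ with $r(\mathbf p)=r(\mathbf q)$. Then $\mathbf p$ and $\mathbf q$ are in the same outcome class (both P-positions or both N-positions).
   Context: The game $SN(n,A)$ is played on $n$ stacks of tokens; a position is $\mathbf p=(p_1,\dots,p_n)$ of nonnegative integers. A move consists of choosing some $\ell\in A$ and $\ell$ distinct stacks, each of height at least $1$, and removing exactly one token from each. Players alternate; a player unable to move loses (normal play); P-/N-positions are those from which the player to move loses/wins under optimal play. A terminal position is one with no legal move. For a position $\mathbf p$, let $\mathcal T(\mathbf p)$ be the set of terminal positions reachable from $\mathbf p$ by finite sequences of legal moves, $u_i(\mathbf p)=\min\{t_i:\mathbf t\in\mathcal T(\mathbf p)\}$, and $r(\mathbf p)=\mathbf p-u(\mathbf p)$. -}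

module Defs where

open import Data.Nat using (ℕ; zero; suc; _∸_; _≤_)
open import Data.Fin using (Fin)
open import Data.Fin.Subset using (Subset; _∈_; _∉_; ∣_∣)
open import Data.List using (List)
import Data.List.Membership.Propositional as LM
open import Data.Product using (Σ; ∃; _×_)
open import Relation.Nullary using (¬_)
open import Relation.Binary.PropositionalEquality using (_≡_)
open import Relation.Binary.Construct.Closure.ReflexiveTransitive using (Star)

-- A position of SN(n,A): heights of the n stacks.
Position : ℕ → Set
Position n = Fin n → ℕ

-- One move of SN(n,A): choose ℓ ∈ A and a set S of exactly ℓ distinct
-- stacks, each of height ≥ 1, and remove one token from each.
-- (suc (q i) ≡ p i forces p i ≥ 1 for i ∈ S.)
Move : (n : ℕ) → List ℕ → Position n → Position n → Set
Move n A p q =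
  Σ ℕ λ ℓ → (ℓ LM.∈ A) × (Σ (Subset n) λ S →
    (∣ S ∣ ≡ ℓ)
    × (∀ i → i ∈ S → suc (q i) ≡ p i)
    × (∀ i → i ∉ S → q i ≡ p i))

Reach : (n : ℕ) → List ℕ → Position n → Position n → Set
Reach n A = Star (Move n A)

Terminal : (n : ℕ) → List ℕ → Position n → Set
Terminal n A t = ∀ q → ¬ Move n A t q

IsU : (n : ℕ) → (A : List ℕ) → Position n → Position n → Set
IsU n A p u = ∀ i →
  (∃ λ t → Reach n A p t × Terminal n A t × t i ≡ u i)
  × (∀ t → Reach n A p t → Terminal n A t → u i ≤ t i)

IsR : (n : ℕ) → (A : List ℕ) → Position n → Position n → Set
IsR n A p r = ∃ λ u → IsU n A p u × (∀ i → r i ≡ p i ∸ u i)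

mutual
  data PPos (n : ℕ) (A : List ℕ) (p : Position n) : Set where
    ppos : (∀ q → Move n A p q → NPos n A q) → PPos n A p

  data NPos (n : ℕ) (A : List ℕ) (p : Position n) : Set where
    npos : (q : Position n) → Move n A p q → PPos n A q → NPos n A p

-- Let u = u(p). Every position x reachable from p can still reach a terminal
-- position, which lies above u, so x ≥ u componentwise. Hence subtracting u
-- maps the moves from x bijectively onto the moves from x − u: the game from p
-- is bisimilar to the game from r(p), and bisimilar positions have the same
-- outcome. Applying this to p and q through their common r gives the result.
module Submission where

open import Defs
open import Data.Nat using (ℕ; zero; suc; pred; >-nonZero; _+_; _∸_; _≤_; _<_; _≟_; _≤?_; z≤n; s≤s)
open import Data.Nat.Properties
  using (≤-refl; ≤-trans; ≤-reflexive; n≤1+n; <⇒≢; +-mono-≤; +-mono-<-≤; +-mono-≤-<;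
         +-∸-assoc; m+n∸n≡m; m∸n+n≡m; suc-pred)
open import Data.Nat.Induction using (<-wellFounded)
open import Data.Fin using () renaming (zero to fzero; suc to fsuc)
open import Data.Fin.Properties using (all?)
open import Data.Fin.Subset using (Subset; _∈_; _∉_; ∣_∣; Nonempty)
open import Data.Fin.Subset.Properties using (_∈?_; anySubset?; nonempty?; Empty-unique; ∣⊥∣≡0)
open import Data.List using (List; [])
open import Data.List.Relation.Unary.All as All using (All)
import Data.List.Membership.Propositional as LM
import Data.List.Membership.DecPropositional as DM
open import Data.Product using (∃; _×_; _,_; proj₁; proj₂)
open import Data.Sum using (_⊎_; inj₁; inj₂)
open import Data.Empty using (⊥-elim)
open import Data.Unit using (⊤; tt)
open import Function using (_∘_; flip)
open import Induction.WellFounded using (WellFounded; Acc; acc; module Subrelation)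
import Relation.Binary.Construct.On as On
open import Relation.Nullary using (¬_; Dec; yes; no; contradiction)
open import Relation.Nullary.Decidable using (_×-dec_; _→-dec_)
open import Relation.Binary.PropositionalEquality
  using (_≡_; _≢_; _≗_; refl; sym; trans; cong; subst)
open import Relation.Binary.Construct.Closure.ReflexiveTransitive using (ε; _◅_; _◅◅_)

private
  variable
    n : ℕ

_⊕_ : Position n → Position n → Position n
(x ⊕ c) i = x i + c i

_⊖_ : Position n → Position n → Position n
(x ⊖ c) i = x i ∸ c i

_≤ₚ_ : Position n → Position n → Set
x ≤ₚ y = ∀ i → x i ≤ y i

total : Position n → ℕ
total {zero}  x = 0
total {suc n} x = x fzero + total (x ∘ fsuc)

total-mono-≤ : {x y : Position n} → x ≤ₚ y → total x ≤ total y
total-mono-≤ {zero}  x≤y = z≤n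
total-mono-≤ {suc n} x≤y = +-mono-≤ (x≤y fzero) (total-mono-≤ (x≤y ∘ fsuc))

total-mono-< : {x y : Position n} → x ≤ₚ y → ∀ j → x j < y j → total x < total y
total-mono-< x≤y fzero    xⱼ<yⱼ = +-mono-<-≤ xⱼ<yⱼ (total-mono-≤ (x≤y ∘ fsuc))
total-mono-< x≤y (fsuc j) xⱼ<yⱼ = +-mono-≤-< (x≤y fzero) (total-mono-< (x≤y ∘ fsuc) j xⱼ<yⱼ)

1≤∣p∣⇒Nonempty : (p : Subset n) → 1 ≤ ∣ p ∣ → Nonempty p
1≤∣p∣⇒Nonempty {n} p 1≤∣p∣ with nonempty? p
... | yes ne = ne
... | no  e  = ⊥-elim (<⇒≢ 1≤∣p∣ (sym (trans (cong ∣_∣ (Empty-unique e)) (∣⊥∣≡0 n))))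

module _ {n : ℕ} {A : List ℕ} where

  move-≤ : ∀ {x q} → Move n A x q → q ≤ₚ x
  move-≤ (_ , _ , S , _ , inS , outS) i with i ∈? S
  ... | yes i∈S = subst (_ ≤_) (inS i i∈S) (n≤1+n _)
  ... | no  i∉S = ≤-reflexive (outS i i∉S)

  reach-≤ : ∀ {x t} → Reach n A x t → t ≤ₚ x
  reach-≤ ε        i = ≤-refl
  reach-≤ (m ◅ ms) i = ≤-trans (reach-≤ ms i) (move-≤ m i)

  move-resp-≗ : ∀ {x x' q} → x ≗ x' → Move n A x q → Move n A x' q
  move-resp-≗ x≗x' (ℓ , ℓ∈A , S , ∣S∣≡ℓ , inS , outS) =
    ℓ , ℓ∈A , S , ∣S∣≡ℓ , (λ i i∈S → trans (inS i i∈S) (x≗x' i))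
                        , (λ i i∉S → trans (outS i i∉S) (x≗x' i))

  move-⊕ : ∀ {x q} c → Move n A x q → Move n A (x ⊕ c) (q ⊕ c)
  move-⊕ c (ℓ , ℓ∈A , S , ∣S∣≡ℓ , inS , outS) =
    ℓ , ℓ∈A , S , ∣S∣≡ℓ , (λ i i∈S → cong (_+ c i) (inS i i∈S))
                        , (λ i i∉S → cong (_+ c i) (outS i i∉S))

  move-⊖ : ∀ {x q c} → c ≤ₚ q → Move n A x q → Move n A (x ⊖ c) (q ⊖ c)
  move-⊖ {x} {q} {c} c≤q (ℓ , ℓ∈A , S , ∣S∣≡ℓ , inS , outS) =
    ℓ , ℓ∈A , S , ∣S∣≡ℓ , (λ i i∈S → suc-∸ i (inS i i∈S))
                        , (λ i i∉S → cong (_∸ c i) (outS i i∉S))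
    where
    suc-∸ : ∀ i → suc (q i) ≡ x i → suc (q i ∸ c i) ≡ x i ∸ c i
    suc-∸ i eq = trans (sym (+-∸-assoc 1 (c≤q i))) (cong (_∸ c i) eq)

  decrementAt : Subset n → Position n → Position n
  decrementAt S x i with i ∈? S
  ... | yes _ = pred (x i)
  ... | no  _ = x i

  Legal : Position n → Subset n → Set
  Legal x S = (∣ S ∣ LM.∈ A) × (∀ i → i ∈ S → 1 ≤ x i)

  legal? : ∀ x S → Dec (Legal x S)
  legal? x S = DM._∈?_ _≟_ ∣ S ∣ A ×-dec all? (λ i → (i ∈? S) →-dec (1 ≤? x i))

  legal⇒move : ∀ {x S} → Legal x S → Move n A x (decrementAt S x)
  legal⇒move {x} {S} (∣S∣∈A , positive) = ∣ S ∣ , ∣S∣∈A , S , refl , inS , outS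
    where
    inS : ∀ i → i ∈ S → suc (decrementAt S x i) ≡ x i
    inS i i∈S with i ∈? S
    ... | yes _   = suc-pred (x i) {{>-nonZero (positive i i∈S)}}
    ... | no  i∉S = contradiction i∈S i∉S
    outS : ∀ i → i ∉ S → decrementAt S x i ≡ x i
    outS i i∉S with i ∈? S
    ... | yes i∈S = contradiction i∈S i∉S
    ... | no  _   = refl

  move⇒legal : ∀ {x q} → Move n A x q → ∃ λ S → Legal x S × q ≗ decrementAt S x
  move⇒legal {x} {q} (ℓ , ℓ∈A , S , ∣S∣≡ℓ , inS , outS) =
    S , (subst (LM._∈ A) (sym ∣S∣≡ℓ) ℓ∈A , λ i i∈S → subst (1 ≤_) (inS i i∈S) (s≤s z≤n)) , q≗
    where
    q≗ : q ≗ decrementAt S x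
    q≗ i with i ∈? S
    ... | yes i∈S = cong pred (inS i i∈S)
    ... | no  i∉S = outS i i∉S

  any-move? : ∀ x (P : Position n → Set) → (∀ {q q'} → q ≗ q' → P q → P q') →
              (∀ {q} → Move n A x q → Dec (P q)) → Dec (∃ λ q → Move n A x q × P q)
  any-move? x P P-resp P? with anySubset? legal-and-P?
    where
    legal-and-P? : ∀ S → Dec (Legal x S × P (decrementAt S x))
    legal-and-P? S with legal? x S
    ... | no ¬legal = no (¬legal ∘ proj₁)
    ... | yes legal with P? (legal⇒move legal)
    ...   | yes p = yes (legal , p)
    ...   | no ¬p = no (¬p ∘ λ (_ , p) → p)
  ... | yes (S , legal , p) = yes (_ , legal⇒move legal , p)
  ... | no ¬legal-and-P = no λ (q , m , p) →
    let S , legal , q≗ = move⇒legal m in ¬legal-and-P (S , legal , P-resp q≗ p)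

  PPos-resp-≗ : ∀ {x y} → x ≗ y → PPos n A x → PPos n A y
  PPos-resp-≗ x≗y (ppos next) = ppos λ q m → next q (move-resp-≗ (sym ∘ x≗y) m)

  PPos⇒¬NPos : ∀ {x} → PPos n A x → ¬ NPos n A x
  PPos⇒¬NPos (ppos next) (npos q m Pq) = PPos⇒¬NPos Pq (next q m)

  record Bisimulation (R : Position n → Position n → Set) : Set where
    field
      forth : ∀ {x y x'} → R x y → Move n A x x' → ∃ λ y' → Move n A y y' × R x' y'
      back  : ∀ {x y y'} → R x y → Move n A y y' → ∃ λ x' → Move n A x x' × R x' y'

  Bisimilar : Position n → Position n → Set₁
  Bisimilar x y = ∃ λ R → Bisimulation R × R x y

  bisimilar-sym : ∀ {x y} → Bisimilar x y → Bisimilar y x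
  bisimilar-sym (R , bisim , xRy) = flip R , record { forth = back ; back = forth } , xRy
    where open Bisimulation bisim

  bisimilar-trans : ∀ {x y z} → Bisimilar x y → Bisimilar y z → Bisimilar x z
  bisimilar-trans (R , R-bisim , xRy) (S , S-bisim , ySz) =
    R⨾S , record { forth = forth ; back = back } , (_ , xRy , ySz)
    where
    module R = Bisimulation R-bisim
    module S = Bisimulation S-bisim
    R⨾S : Position n → Position n → Set
    R⨾S a c = ∃ λ b → R a b × S b c
    forth : ∀ {a c a'} → R⨾S a c → Move n A a a' → ∃ λ c' → Move n A c c' × R⨾S a' c'
    forth (b , aRb , bSc) m with R.forth aRb m
    ... | b' , m' , a'Rb' with S.forth bSc m'
    ...   | c' , m'' , b'Sc' = c' , m'' , (b' , a'Rb' , b'Sc')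
    back : ∀ {a c c'} → R⨾S a c → Move n A c c' → ∃ λ a' → Move n A a a' × R⨾S a' c'
    back (b , aRb , bSc) m with S.back bSc m
    ... | b' , m' , b'Sc' with R.back aRb m'
    ...   | a' , m'' , a'Rb' = a' , m'' , (b' , a'Rb' , b'Sc')

  module _ {R : Position n → Position n → Set} (bisim : Bisimulation R) where
    open Bisimulation bisim

    mutual
      PPos-bisim : ∀ {x y} → R x y → PPos n A x → PPos n A y
      PPos-bisim xRy (ppos next) = ppos λ y' m →
        let x' , m' , x'Ry' = back xRy m in NPos-bisim x'Ry' (next x' m')

      NPos-bisim : ∀ {x y} → R x y → NPos n A x → NPos n A y
      NPos-bisim xRy (npos x' m Px') =
        let y' , m' , x'Ry' = forth xRy m in npos y' m' (PPos-bisim x'Ry' Px')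

  outcome-bisimilar : ∀ {x y} → Bisimilar x y → PPos n A x ⊎ NPos n A x →
                      (PPos n A x × PPos n A y) ⊎ (NPos n A x × NPos n A y)
  outcome-bisimilar (_ , bisim , xRy) (inj₁ Px) = inj₁ (Px , PPos-bisim bisim xRy Px)
  outcome-bisimilar (_ , bisim , xRy) (inj₂ Nx) = inj₂ (Nx , NPos-bisim bisim xRy Nx)

  module _ (A⁺ : All (1 ≤_) A) where

    move-decreases-total : ∀ {x q} → Move n A x q → total q < total x
    move-decreases-total m@(_ , ℓ∈A , S , ∣S∣≡ℓ , inS , _)
      with 1≤∣p∣⇒Nonempty S (subst (1 ≤_) (sym ∣S∣≡ℓ) (All.lookup A⁺ ℓ∈A))
    ... | i , i∈S = total-mono-< (move-≤ m) i (≤-reflexive (inS i i∈S))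

    move-wellFounded : WellFounded (flip (Move n A))
    move-wellFounded =
      Subrelation.wellFounded move-decreases-total (On.wellFounded total <-wellFounded)

    terminal-reachable : ∀ x → ∃ λ t → Reach n A x t × Terminal n A t
    terminal-reachable x = go x (move-wellFounded x)
      where
      go : ∀ x → Acc (flip (Move n A)) x → ∃ λ t → Reach n A x t × Terminal n A t
      go x (acc rs) with any-move? x (λ _ → ⊤) (λ _ _ → tt) (λ _ → yes tt)
      ... | yes (q , m , _) = let t , q↠t , terminal = go q (rs m) in t , m ◅ q↠t , terminal
      ... | no  stuck       = x , ε , λ q m → stuck (q , m , tt)

    determined : ∀ x → PPos n A x ⊎ NPos n A x
    determined x = go x (move-wellFounded x)
      where
      go : ∀ x → Acc (flip (Move n A)) x → PPos n A x ⊎ NPos n A x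
      go x (acc rs) with any-move? x (PPos n A) PPos-resp-≗ (λ m → P? (go _ (rs m)))
        where
        P? : ∀ {q} → PPos n A q ⊎ NPos n A q → Dec (PPos n A q)
        P? (inj₁ Pq) = yes Pq
        P? (inj₂ Nq) = no λ Pq → PPos⇒¬NPos Pq Nq
      ... | yes (q , m , Pq) = inj₂ (npos q m Pq)
      ... | no  ¬winning     = inj₁ (ppos λ q m → NPos-if-not-PPos q m (go q (rs m)))
        where
        NPos-if-not-PPos : ∀ q → Move n A x q → PPos n A q ⊎ NPos n A q → NPos n A q
        NPos-if-not-PPos q m (inj₁ Pq) = ⊥-elim (¬winning (q , m , Pq))
        NPos-if-not-PPos q m (inj₂ Nq) = Nq

    IsU⇒≤-reachable : ∀ {p u x} → IsU n A p u → Reach n A p x → u ≤ₚ x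
    IsU⇒≤-reachable {x = x} isU p↠x i =
      let t , x↠t , terminal = terminal-reachable x
      in ≤-trans (isU i .proj₂ t (p↠x ◅◅ x↠t) terminal) (reach-≤ x↠t i)

    IsR⇒bisimilar : ∀ {p r} → IsR n A p r → Bisimilar p r
    IsR⇒bisimilar {p} {r} (u , isU , r≗p⊖u) = Shifted , bisim , (ε , p≗r⊕u)
      where
      Shifted : Position n → Position n → Set
      Shifted x y = Reach n A p x × x ≗ y ⊕ u

      ⊖⊕-cancel : ∀ {x} → Reach n A p x → x ≗ (x ⊖ u) ⊕ u
      ⊖⊕-cancel p↠x i = sym (m∸n+n≡m (IsU⇒≤-reachable isU p↠x i))

      p≗r⊕u : p ≗ r ⊕ u
      p≗r⊕u i = trans (⊖⊕-cancel ε i) (cong (_+ u i) (sym (r≗p⊖u i)))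

      bisim : Bisimulation Shifted
      bisim = record { forth = forth ; back = back }
        where
        forth : ∀ {x y x'} → Shifted x y → Move n A x x' → ∃ λ y' → Move n A y y' × Shifted x' y'
        forth {y = y} (p↠x , x≗y⊕u) m =
          let p↠x' = p↠x ◅◅ (m ◅ ε)
              x⊖u≗y i = trans (cong (_∸ u i) (x≗y⊕u i)) (m+n∸n≡m (y i) (u i))
          in _ , move-resp-≗ x⊖u≗y (move-⊖ (IsU⇒≤-reachable isU p↠x') m)
               , (p↠x' , ⊖⊕-cancel p↠x')
        back : ∀ {x y y'} → Shifted x y → Move n A y y' → ∃ λ x' → Move n A x x' × Shifted x' y'
        back (p↠x , x≗y⊕u) m =
          let m' = move-resp-≗ (sym ∘ x≗y⊕u) (move-⊕ u m)
          in _ , m' , (p↠x ◅◅ (m' ◅ ε) , λ _ → refl)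

corollary1 : (n : ℕ) → 1 ≤ n → (A : List ℕ) → All (λ ℓ → 1 ≤ ℓ × ℓ ≤ n) A → A ≢ [] →
    (p q : Position n) → (∃ λ r → IsR n A p r × IsR n A q r) →
    (PPos n A p × PPos n A q) ⊎ (NPos n A p × NPos n A q)
corollary1 n _ A A-bounds _ p q (r , p↦r , q↦r) = outcome-bisimilar p∼q (determined A⁺ p)
  where
  A⁺ : All (1 ≤_) A
  A⁺ = All.map proj₁ A-bounds

  p∼q : Bisimilar p q
  p∼q = bisimilar-trans (IsR⇒bisimilar A⁺ p↦r) (bisimilar-sym (IsR⇒bisimilar A⁺ q↦r))
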